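{- Let $r \geq 4$ and $n \geq 2r$, and let $G$ be a graph on $n$ vertices with $\delta(G) \geq \lfloor n/2 \rfloor + 1$. Let $A \subseteq V(G)$ satisfy $|A| = \lceil n/2 \rceil + r - 3$ and $\langle A \rangle_r = A$. Then $G[V(G) \setminus A]$ is a complete graph and every vertex of $V(G) \setminus A$ has exactly $r-1$ neighbours in $A$.
   Context: Graphs are finite and simple; $\delta(G)$ is the minimum degree, $N(v)$ the neighbourhood of $v$, and $G[S]$ the subgraph induced by $S$. For an integer $r \geq 2$, the $r$-neighbour bootstrap process on $G$ started from $A \subseteq V(G)$ is defined by $A_0 = A$ and $A_t = A_{t-1} \cup \{v \in V(G) : |N(v) \cap A_{t-1}| \geq r\}$ for $t \geq 1$. The closure is $\langle A \rangle_r = \bigcup_{t \geq 0} A_t$. -}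

module Defs where

open import Data.Nat using (ℕ; zero; suc; _≤ᵇ_)
open import Data.Bool using (Bool; true; false)
open import Data.Fin using (Fin)
open import Data.Fin.Subset using (Subset; _∪_; _∩_; ∣_∣; _∈_)
open import Data.Vec using (tabulate)
open import Data.Product using (∃)
open import Relation.Binary.PropositionalEquality using (_≡_)
open import Function.Bundles using (_⇔_)

record Graph (n : ℕ) : Set where
  field
    adj   : Fin n → Fin n → Bool
    sym   : ∀ u v → adj u v ≡ adj v u
    irrefl : ∀ v → adj v v ≡ false

open Graph public

N : ∀ {n} → Graph n → Fin n → Subset n
N G v = tabulate (adj G v)

deg : ∀ {n} → Graph n → Fin n → ℕ
deg G v = ∣ N G v ∣

minDeg≥ : ∀ {n} → Graph n → ℕ → Set
minDeg≥ G d = ∀ v → d Data.Nat.≤ deg G v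

step : ∀ {n} → Graph n → ℕ → Subset n → Subset n
step G r A = A ∪ tabulate (λ v → r ≤ᵇ ∣ N G v ∩ A ∣)

bootstrap : ∀ {n} → Graph n → ℕ → Subset n → ℕ → Subset n
bootstrap G r A zero    = A
bootstrap G r A (suc t) = step G r (bootstrap G r A t)

_∈⟨_⟩[_,_] : ∀ {n} → Fin n → Subset n → Graph n → ℕ → Set
v ∈⟨ A ⟩[ G , r ] = ∃ λ t → v ∈ bootstrap G r A t

Closed : ∀ {n} → Graph n → ℕ → Subset n → Set
Closed G r A = ∀ v → (v ∈⟨ A ⟩[ G , r ]) ⇔ (v ∈ A)

-- A vertex v outside the closed set A has fewer than r neighbours in A,
-- so at least ⌊n/2⌋ + 1 − (r − 1) = |V∖A| − 1 of its neighbours lie in V∖A.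
-- As v is not its own neighbour it is adjacent to all of V∖A, and then the
-- same count shows it has at least, hence exactly, r − 1 neighbours in A.
module Submission where

open import Defs hiding (sym)
open import Data.Nat using (ℕ; zero; suc; _≤_; _<_; _+_; _∸_; _*_; _/_; ⌊_/2⌋; ⌈_/2⌉; s≤s; z≤n; _≤?_)
open import Data.Nat.Properties
open import Data.Nat.DivMod using (m/n≡1+[m∸n]/n)
open import Data.Bool using (Bool; true; false)
open import Data.Bool.Properties using (T-≡)
open import Data.Vec using ([]; _∷_; tabulate)
open import Data.Vec.Properties using (lookup∘tabulate; lookup⇒[]=; []=⇒lookup)
open import Data.Fin using (Fin)
open import Data.Fin.Subset using (Subset; _∈_; _∉_; _∩_; ∁; _⊆_; _-_; ∣_∣)
open import Data.Fin.Subset.Properties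
open import Data.Product using (_×_; _,_)
open import Data.Sum using (inj₂)
open import Data.Empty using (⊥-elim)
open import Relation.Nullary using (yes; no)
open import Relation.Binary.PropositionalEquality
open import Function using (_∘_)
open import Function.Bundles using (_⇔_; mk⇔; Equivalence)

n/2≡⌊n/2⌋ : ∀ n → n / 2 ≡ ⌊ n /2⌋
n/2≡⌊n/2⌋ zero          = refl
n/2≡⌊n/2⌋ (suc zero)    = refl
n/2≡⌊n/2⌋ (suc (suc n)) =
  trans (m/n≡1+[m∸n]/n {suc (suc n)} {2} (s≤s (s≤s z≤n))) (cong suc (n/2≡⌊n/2⌋ n))

∣p∣≡∣p∩q∣+∣p∩∁q∣ : ∀ {n} (p q : Subset n) → ∣ p ∣ ≡ ∣ p ∩ q ∣ + ∣ p ∩ ∁ q ∣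
∣p∣≡∣p∩q∣+∣p∩∁q∣ []          []          = refl
∣p∣≡∣p∩q∣+∣p∩∁q∣ (true  ∷ p) (true  ∷ q) = cong suc (∣p∣≡∣p∩q∣+∣p∩∁q∣ p q)
∣p∣≡∣p∩q∣+∣p∩∁q∣ (true  ∷ p) (false ∷ q) =
  trans (cong suc (∣p∣≡∣p∩q∣+∣p∩∁q∣ p q)) (sym (+-suc _ _))
∣p∣≡∣p∩q∣+∣p∩∁q∣ (false ∷ p) (true  ∷ q) = ∣p∣≡∣p∩q∣+∣p∩∁q∣ p q
∣p∣≡∣p∩q∣+∣p∩∁q∣ (false ∷ p) (false ∷ q) = ∣p∣≡∣p∩q∣+∣p∩∁q∣ p q

∣∁p∣+∣p∣≡n : ∀ {n} (p : Subset n) → ∣ ∁ p ∣ + ∣ p ∣ ≡ n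
∣∁p∣+∣p∣≡n p = trans (cong (_+ ∣ p ∣) (∣∁p∣≡n∸∣p∣ p)) (m∸n+n≡m (∣p∣≤n p))

∣p∣≡⌈n/2⌉+k⇒∣∁p∣+k≡⌊n/2⌋ : ∀ {n k} (p : Subset n) → ∣ p ∣ ≡ ⌈ n /2⌉ + k → ∣ ∁ p ∣ + k ≡ ⌊ n /2⌋
∣p∣≡⌈n/2⌉+k⇒∣∁p∣+k≡⌊n/2⌋ {n} {k} p ∣p∣≡ = +-cancelʳ-≡ ⌈ n /2⌉ _ _ (begin
  ∣ ∁ p ∣ + k + ⌈ n /2⌉    ≡⟨ +-assoc ∣ ∁ p ∣ k ⌈ n /2⌉ ⟩
  ∣ ∁ p ∣ + (k + ⌈ n /2⌉)  ≡⟨ cong (∣ ∁ p ∣ +_) (+-comm k ⌈ n /2⌉) ⟩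
  ∣ ∁ p ∣ + (⌈ n /2⌉ + k)  ≡⟨ cong (∣ ∁ p ∣ +_) (sym ∣p∣≡) ⟩
  ∣ ∁ p ∣ + ∣ p ∣          ≡⟨ ∣∁p∣+∣p∣≡n p ⟩
  n                        ≡⟨ sym (⌊n/2⌋+⌈n/2⌉≡n n) ⟩
  ⌊ n /2⌋ + ⌈ n /2⌉        ∎)
  where open ≡-Reasoning

x∈tabulate⇔ : ∀ {n} {f : Fin n → Bool} {x} → x ∈ tabulate f ⇔ f x ≡ true
x∈tabulate⇔ {f = f} {x} = mk⇔
  (λ x∈ → trans (sym (lookup∘tabulate f x)) ([]=⇒lookup x∈))
  (λ fx → lookup⇒[]= x (tabulate f) (trans (lookup∘tabulate f x) fx))

module _ {n : ℕ} where

  p⊆q∧x∉p⇒p⊆q-x : ∀ {p q : Subset n} {x} → p ⊆ q → x ∉ p → p ⊆ q - x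
  p⊆q∧x∉p⇒p⊆q-x p⊆q x∉p y∈p = x∈p∧x≢y⇒x∈p-y (p⊆q y∈p) λ { refl → x∉p y∈p }

  p⊆q-x⇒∣p∣<∣q∣ : ∀ {p q : Subset n} {x} → x ∈ q → p ⊆ q - x → ∣ p ∣ < ∣ q ∣
  p⊆q-x⇒∣p∣<∣q∣ x∈q p⊆q-x = ≤-<-trans (p⊆q⇒∣p∣≤∣q∣ p⊆q-x) (x∈p⇒∣p-x∣<∣p∣ x∈q)

  p⊆q-x-y⇒2+∣p∣≤∣q∣ : ∀ {p q : Subset n} {x y} → x ∈ q → y ∈ q → y ≢ x → p ⊆ q - x - y → 2 + ∣ p ∣ ≤ ∣ q ∣
  p⊆q-x-y⇒2+∣p∣≤∣q∣ x∈q y∈q y≢x p⊆q-x-y =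
    ≤-trans (s≤s (p⊆q-x⇒∣p∣<∣q∣ (x∈p∧x≢y⇒x∈p-y y∈q y≢x) p⊆q-x-y)) (x∈p⇒∣p-x∣<∣p∣ x∈q)

module _ {n} (G : Graph n) where

  adj≡false⇒∉N : ∀ {u v} → adj G v u ≡ false → u ∉ N G v
  adj≡false⇒∉N ¬vu u∈N with trans (sym (Equivalence.to x∈tabulate⇔ u∈N)) ¬vu
  ... | ()

  N∩q⊆q-v : ∀ v q → N G v ∩ q ⊆ q - v
  N∩q⊆q-v v q = p⊆q∧x∉p⇒p⊆q-x (p∩q⊆q _ _) (adj≡false⇒∉N (irrefl G v) ∘ p∩q⊆p _ _)

  N∩q⊆q-v-u : ∀ {u} v q → adj G v u ≡ false → N G v ∩ q ⊆ q - v - u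
  N∩q⊆q-v-u v q ¬vu = p⊆q∧x∉p⇒p⊆q-x (N∩q⊆q-v v q) (adj≡false⇒∉N ¬vu ∘ p∩q⊆p _ _)

  Closed⇒∣N∩A∣<r : ∀ {r A v} → Closed G r A → v ∉ A → ∣ N G v ∩ A ∣ < r
  Closed⇒∣N∩A∣<r {r} {A} {v} closed v∉A with r ≤? ∣ N G v ∩ A ∣
  ... | no  r≰ = ≰⇒> r≰
  ... | yes r≤ = ⊥-elim (v∉A (Equivalence.to (closed v) (1 , v∈A₁)))
    where
    v∈A₁ : v ∈ step G r A
    v∈A₁ = x∈p∪q⁺ (inj₂ (Equivalence.from x∈tabulate⇔ (Equivalence.to T-≡ (≤⇒≤ᵇ r≤))))

  m+1+k≤∣N∩A∣ : ∀ {d k m v} A → suc d ≤ deg G v → ∣ ∁ A ∣ + k ≡ d →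
                m + ∣ N G v ∩ ∁ A ∣ ≤ ∣ ∁ A ∣ → m + (1 + k) ≤ ∣ N G v ∩ A ∣
  m+1+k≤∣N∩A∣ {d} {k} {m} {v} A d<deg ∣∁A∣+k≡d deficit = +-cancelˡ-≤ outside _ _ (begin
    outside + (m + suc k)  ≡⟨ sym (+-assoc outside m (suc k)) ⟩
    outside + m + suc k    ≡⟨ cong (_+ suc k) (+-comm outside m) ⟩
    m + outside + suc k    ≤⟨ +-monoˡ-≤ (suc k) deficit ⟩
    ∣ ∁ A ∣ + suc k        ≡⟨ +-suc ∣ ∁ A ∣ k ⟩
    suc (∣ ∁ A ∣ + k)      ≡⟨ cong suc ∣∁A∣+k≡d ⟩
    suc d                  ≤⟨ d<deg ⟩
    deg G v                ≡⟨ ∣p∣≡∣p∩q∣+∣p∩∁q∣ (N G v) A ⟩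
    inside + outside       ≡⟨ +-comm inside outside ⟩
    outside + inside       ∎)
    where
    open ≤-Reasoning
    inside  = ∣ N G v ∩ A ∣
    outside = ∣ N G v ∩ ∁ A ∣

fact4p6 : (r n : ℕ) → 4 ≤ r → 2 * r ≤ n → (G : Graph n) →
  minDeg≥ G (n / 2 + 1) →
  (A : Subset n) → ∣ A ∣ ≡ ⌈ n /2⌉ + r ∸ 3 → Closed G r A →
  (∀ u v → u ∉ A → v ∉ A → u ≢ v → adj G u v ≡ true)
  × (∀ v → v ∉ A → ∣ N G v ∩ A ∣ ≡ r ∸ 1)
fact4p6 (suc (suc (suc k))) n (s≤s (s≤s (s≤s _))) _ G δ≥ A ∣A∣≡ closed = complete , exact
  where
  ∣A∣≡⌈n/2⌉+k : ∣ A ∣ ≡ ⌈ n /2⌉ + k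
  ∣A∣≡⌈n/2⌉+k = trans ∣A∣≡ (+-∸-assoc ⌈ n /2⌉ {3 + k} (s≤s (s≤s (s≤s z≤n))))

  δ≥′ : ∀ v → suc ⌊ n /2⌋ ≤ deg G v
  δ≥′ v = subst (_≤ deg G v) (trans (+-comm (n / 2) 1) (cong suc (n/2≡⌊n/2⌋ n))) (δ≥ v)

  few : ∀ {v} → v ∉ A → ∣ N G v ∩ A ∣ < 3 + k
  few = Closed⇒∣N∩A∣<r G closed

  many : ∀ {v} m → m + ∣ N G v ∩ ∁ A ∣ ≤ ∣ ∁ A ∣ → m + (1 + k) ≤ ∣ N G v ∩ A ∣
  many {v} m = m+1+k≤∣N∩A∣ G A (δ≥′ v) (∣p∣≡⌈n/2⌉+k⇒∣∁p∣+k≡⌊n/2⌋ A ∣A∣≡⌈n/2⌉+k)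

  complete : ∀ u v → u ∉ A → v ∉ A → u ≢ v → adj G u v ≡ true
  complete u v u∉A v∉A u≢v with adj G u v in uv
  ... | true  = refl
  ... | false = ⊥-elim (<⇒≱ (few v∉A) (many 2 (p⊆q-x-y⇒2+∣p∣≤∣q∣
        (x∉p⇒x∈∁p v∉A) (x∉p⇒x∈∁p u∉A) u≢v (N∩q⊆q-v-u G v (∁ A) (trans (Graph.sym G v u) uv)))))

  exact : ∀ v → v ∉ A → ∣ N G v ∩ A ∣ ≡ 2 + k
  exact v v∉A = ≤-antisym (≤-pred (few v∉A))
    (many 1 (p⊆q-x⇒∣p∣<∣q∣ (x∉p⇒x∈∁p v∉A) (N∩q⊆q-v G v (∁ A))))
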